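{- Let $(E,\mathcal{C},r_{\mathcal{C}})$ be a semimatroid and let $\bm x=\{x_f\}_{f\in E}$ be indeterminates. For $e\in E$ put $\bm x_{ -e}:=\{x_f\}_{f\in E-e}$. Then: (i) if $e$ is a loop, $Z(\mathcal{C};\lambda,\bm x)=(x_e+1)Z(\mathcal{C}\backslash e;\lambda,\bm x_{ -e})$; (ii) if $e$ is an isthmus, $Z(\mathcal{C};\lambda,\bm x)=(\frac{x_e}{\lambda}+1)Z(\mathcal{C}\backslash e;\lambda,\bm x_{ -e})$; (iii) if $\{e\}\in\mathcal{C}$ and $e$ is neither a loop nor an isthmus, $Z(\mathcal{C};\lambda,\bm x)=Z(\mathcal{C}\backslash e;\lambda,\bm x_{ -e})+\frac{x_e}{\lambda}Z(\mathcal{C}/e;\lambda,\bm x_{ -e})$; (iv) if $\{e\}\notin\mathcal{C}$, $Z(\mathcal{C};\lambda,\bm x)=Z(\mathcal{C}\backslash e;\lambda,\bm x_{ -e})$.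
   Context: A semimatroid is a triple $(E,\mathcal{C},r_{\mathcal{C}})$ where $E$ is a finite set, $\mathcal{C}$ is a nonempty simplicial complex on $E$ (a nonempty family of subsets of $E$ closed under taking subsets), and $r_{\mathcal{C}}:\mathcal{C}\to\mathbb{N}$ satisfies: (SR1) $0\le r_{\mathcal{C}}(X)\le |X|$; (SR2) $X\subseteq Y$ in $\mathcal{C}$ implies $r_{\mathcal{C}}(X)\le r_{\mathcal{C}}(Y)$; (SR3) if $X,Y,X\cup Y\in\mathcal{C}$ then $r_{\mathcal{C}}(X\cap Y)+r_{\mathcal{C}}(X\cup Y)\le r_{\mathcal{C}}(X)+r_{\mathcal{C}}(Y)$; (SR4) if $X,Y\in\mathcal{C}$ and $r_{\mathcal{C}}(X)=r_{\mathcal{C}}(X\cap Y)$ then $X\cup Y\in\mathcal{C}$; (SR5) if $X,Y\in\mathcal{C}$ and $r_{\mathcal{C}}(X)<r_{\mathcal{C}}(Y)$ then $X\cup\{e\}\in\mathcal{C}$ for some $e\in Y-X$. Members of $\mathcal{C}$ are central sets. A central set $X$ is independent if $r_{\mathcal{C}}(X)=|X|$; a basis is a maximal independent central set; a circuit is a minimal dependent central set. An element $e$ is a loop if $\{e\}\in\mathcal{C}$ and $r_{\mathcal{C}}(\{e\})=0$; $e$ is an isthmus if $\{e\}\in\mathcal{C}$ and $e$ lies in every basis. Deletion: $\mathcal{C}\backslash e$ is the semimatroid on $E-e$ with central sets $\{Y\subseteq E-e: Y\in\mathcal{C}\}$ and rank $r_{\mathcal{C}}$ restricted. Contraction (for $\{e\}\in\mathcal{C}$):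 $\mathcal{C}/e$ is the semimatroid on $E-e$ with central sets $\{Y\subseteq E-e: Y\cup\{e\}\in\mathcal{C}\}$ and rank $r_{\mathcal{C}/e}(Y)=r_{\mathcal{C}}(Y\cup\{e\})-r_{\mathcal{C}}(\{e\})$. For a semimatroid $\mathcal{C}$ on ground set $E$ and indeterminates $\bm x=\{x_e\}_{e\in E}$, the multivariate Tutte polynomial is $Z(\mathcal{C};\lambda,\bm x)=\sum_{A\in\mathcal{C}}\lambda^{ -r_{\mathcal{C}}(A)}\bm x^A$, where $\bm x^A=\prod_{e\in A}x_e$. -}

module Defs where

open import Level using (Level)
open import Data.Nat using (ℕ; zero; suc; _≤_; _<_; _∸_) renaming (_+_ to _+ℕ_)
open import Data.Bool using (Bool; true; false)
open import Data.Fin using (Fin; zero; suc; punchIn)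
open import Data.Fin.Subset using (Subset; inside; outside; _∈_; _∉_; _⊆_; _∪_; _∩_; ⁅_⁆; ∣_∣)
open import Data.Vec using (Vec; []; _∷_; insertAt)
open import Data.List using (List; []; _∷_; map; _++_)
open import Data.Product using (Σ; ∃; _×_; _,_)
open import Relation.Binary.PropositionalEquality using (_≡_)
open import Relation.Nullary using (¬_)
open import Algebra.Bundles using (CommutativeRing)

-- The rank function is taken total on all subsets; only its values on
-- central sets matter (all axioms and Z only look at central sets).
record PreSemimatroid (n : ℕ) : Set where
  field
    central : Subset n → Bool
    rank    : Subset n → ℕ

module _ {n : ℕ} (C : PreSemimatroid n) where
  open PreSemimatroid C

  IsCentral : Subset n → Set
  IsCentral X = central X ≡ true

  IsIndependent : Subset n → Set
  IsIndependent X = IsCentral X × rank X ≡ ∣ X ∣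

  IsDependent : Subset n → Set
  IsDependent X = IsCentral X × ¬ (rank X ≡ ∣ X ∣)

  IsBasis : Subset n → Set
  IsBasis B = IsIndependent B × (∀ Y → IsIndependent Y → B ⊆ Y → Y ≡ B)

  IsCircuit : Subset n → Set
  IsCircuit X = IsDependent X × (∀ Y → IsDependent Y → Y ⊆ X → Y ≡ X)

  IsLoop : Fin n → Set
  IsLoop e = IsCentral ⁅ e ⁆ × rank ⁅ e ⁆ ≡ 0

  IsIsthmus : Fin n → Set
  IsIsthmus e = IsCentral ⁅ e ⁆ × (∀ B → IsBasis B → e ∈ B)

  record IsSemimatroid : Set where
    field
      nonempty : ∃ λ X → IsCentral X
      downClosed : ∀ X Y → X ⊆ Y → IsCentral Y → IsCentral X
      SR1 : ∀ X → IsCentral X → rank X ≤ ∣ X ∣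
      SR2 : ∀ X Y → IsCentral X → IsCentral Y → X ⊆ Y → rank X ≤ rank Y
      SR3 : ∀ X Y → IsCentral X → IsCentral Y → IsCentral (X ∪ Y) →
            rank (X ∩ Y) +ℕ rank (X ∪ Y) ≤ rank X +ℕ rank Y
      SR4 : ∀ X Y → IsCentral X → IsCentral Y → rank X ≡ rank (X ∩ Y) →
            IsCentral (X ∪ Y)
      SR5 : ∀ X Y → IsCentral X → IsCentral Y → rank X < rank Y →
            ∃ λ e → e ∈ Y × e ∉ X × IsCentral (X ∪ ⁅ e ⁆)

record Semimatroid (n : ℕ) : Set where
  field
    pre : PreSemimatroid n
    isSemimatroid : IsSemimatroid pre
  open PreSemimatroid pre public

-- Deletion C \ e on E - e ≅ Fin n (via punchIn e); a subset Y of E - e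
-- corresponds to insertAt Y e outside.
deletion : ∀ {n} → PreSemimatroid (suc n) → Fin (suc n) → PreSemimatroid n
deletion C e = record
  { central = λ Y → PreSemimatroid.central C (insertAt Y e outside)
  ; rank    = λ Y → PreSemimatroid.rank C (insertAt Y e outside) }

contraction : ∀ {n} → PreSemimatroid (suc n) → Fin (suc n) → PreSemimatroid n
contraction C e = record
  { central = λ Y → PreSemimatroid.central C (insertAt Y e inside)
  ; rank    = λ Y → PreSemimatroid.rank C (insertAt Y e inside)
                      ∸ PreSemimatroid.rank C ⁅ e ⁆ }

allSubsets : ∀ n → List (Subset n)
allSubsets zero = [] ∷ []
allSubsets (suc n) = map (outside ∷_) (allSubsets n) ++ map (inside ∷_) (allSubsets n)

module Poly {c ℓ : Level} (R : CommutativeRing c ℓ) where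
  open CommutativeRing R using (Carrier; _+_; _*_; 0#; 1#)

  pow : Carrier → ℕ → Carrier
  pow a zero = 1#
  pow a (suc k) = a * pow a k

  monomial : ∀ {n} → (Fin n → Carrier) → Subset n → Carrier
  monomial x [] = 1#
  monomial x (true ∷ A) = x zero * monomial (λ i → x (suc i)) A
  monomial x (false ∷ A) = monomial (λ i → x (suc i)) A

  sumList : List Carrier → Carrier
  sumList [] = 0#
  sumList (a ∷ as) = a + sumList as

  -- Z(C; λ, x) = Σ_{A ∈ C} λ^{-r(A)} x^A, evaluated at λ⁻¹ = μ (μ the inverse of λ).
  term : ∀ {n} → PreSemimatroid n → Carrier → (Fin n → Carrier) → Subset n → Carrier
  term C μ x A with PreSemimatroid.central C A
  ... | true  = pow μ (PreSemimatroid.rank C A) * monomial x A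
  ... | false = 0#

  Z : ∀ {n} → PreSemimatroid n → Carrier → (Fin n → Carrier) → Carrier
  Z {n} C μ x = sumList (map (term C μ x) (allSubsets n))

-- Split the sum over A ∈ 𝒞 according to whether e ∈ A.  The sets with e ∉ A are
-- exactly the central sets of 𝒞 \ e, with the same rank and monomial.  A set with
-- e ∈ A is Y ∪ {e} for Y ⊆ E - e, and its monomial carries an extra x_e.  If e is
-- a loop, Y ∪ {e} is central iff Y is, with the same rank; if e is an isthmus,
-- the same holds with rank raised by one (e extends a maximal independent subset
-- of Y to an independent set, and SR4 makes Y ∪ {e} central); if {e} is central
-- and not a loop, r({e}) = 1 and the terms are those of 𝒞 / e times x_e λ⁻¹; if
-- {e} is not central, no Y ∪ {e} is.
module Submission where

open import Defs
open import Level using (Level)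
open import Algebra.Bundles using (CommutativeRing)
import Algebra.Properties.CommutativeSemigroup as CommutativeSemigroupProperties
open import Data.Bool using (Bool; true; false)
open import Data.Bool.Properties using (¬-not; ∨-identityʳ) renaming (_≟_ to _≟ᵇ_)
open import Data.Empty using (⊥-elim)
open import Data.Fin using (Fin; zero; suc; punchIn)
open import Data.Fin.Subset
open import Data.Fin.Subset.Properties
open import Data.List using (List; []; _∷_; map; _++_)
open import Data.List.Properties using (map-++; map-∘)
open import Data.Nat using (ℕ; zero; suc; _≤_; _<_; _∸_; s≤s) renaming (_+_ to _+ℕ_)
import Data.Nat.Properties as ℕ
open import Data.Nat.Properties
  using (≤-refl; ≤-trans; ≤-reflexive; ≤-antisym; +-suc; +-monoʳ-≤; +-mono-≤; n≢0⇒n>0;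
         +-cancelˡ-≤; ≮⇒≥; <⇒≱; ≤∧≢⇒<; m≤m+n; m≤n+m; m∸n+n≡m; m+[n∸m]≡n; n≤0⇒n≡0;
         _≟_; _≤?_; module ≤-Reasoning)
open import Data.Product using (∃; _×_; _,_; proj₁; proj₂)
open import Data.Sum using (_⊎_; inj₁; inj₂)
open import Data.Vec using (_∷_; insertAt; here; there)
open import Data.Vec.Properties using (insertAt-lookup; []=⇒lookup; lookup⇒[]=)
import Relation.Binary.PropositionalEquality as ≡
open ≡ using (_≡_; refl; cong; cong₂; subst)
open import Relation.Nullary using (¬_; yes; no)
open import Relation.Nullary.Decidable using (_×-dec_)
open import Relation.Unary using (Decidable)

private
  variable
    m : ℕ
    p q r : Subset m

∪-least : p ⊆ r → q ⊆ r → p ∪ q ⊆ r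
∪-least {p = p} {q = q} p⊆r q⊆r x∈p∪q with x∈p∪q⁻ p q x∈p∪q
... | inj₁ x∈p = p⊆r x∈p
... | inj₂ x∈q = q⊆r x∈q

x∈p⇒⁅x⁆⊆p : ∀ {x : Fin m} → x ∈ p → ⁅ x ⁆ ⊆ p
x∈p⇒⁅x⁆⊆p {p = p} {x} x∈p y∈⁅x⁆ = subst (_∈ p) (≡.sym (x∈⁅y⁆⇒x≡y x y∈⁅x⁆)) x∈p

∣p∪⁅x⁆∣≡1+∣p∣ : ∀ (p : Subset m) x → x ∉ p → ∣ p ∪ ⁅ x ⁆ ∣ ≡ suc ∣ p ∣
∣p∪⁅x⁆∣≡1+∣p∣ (outside ∷ p) zero    _   = cong suc (cong ∣_∣ (∪-identityʳ p))
∣p∪⁅x⁆∣≡1+∣p∣ (inside  ∷ p) zero    x∉p = ⊥-elim (x∉p here)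
∣p∪⁅x⁆∣≡1+∣p∣ (outside ∷ p) (suc x) x∉p = ∣p∪⁅x⁆∣≡1+∣p∣ p x (λ x∈p → x∉p (there x∈p))
∣p∪⁅x⁆∣≡1+∣p∣ (inside  ∷ p) (suc x) x∉p = cong suc (∣p∪⁅x⁆∣≡1+∣p∣ p x (λ x∈p → x∉p (there x∈p)))

p⊆q⇒q≡p⊎p⊂q : p ⊆ q → q ≡ p ⊎ p ⊂ q
p⊆q⇒q≡p⊎p⊂q {p = p} {q = q} p⊆q with p ⊂? q
... | yes p⊂q = inj₂ p⊂q
... | no  p⊄q = inj₁ (⊆-antisym q⊆p p⊆q)
  where
  q⊆p : q ⊆ p
  q⊆p {x} x∈q with x ∈? p
  ... | yes x∈p = x∈p
  ... | no  x∉p = ⊥-elim (p⊄q (p⊆q , x , x∈q , x∉p))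

p⊆q∧∣q∣≤∣p∣⇒q≡p : p ⊆ q → ∣ q ∣ ≤ ∣ p ∣ → q ≡ p
p⊆q∧∣q∣≤∣p∣⇒q≡p p⊆q ∣q∣≤∣p∣ with p⊆q⇒q≡p⊎p⊂q p⊆q
... | inj₁ q≡p = q≡p
... | inj₂ p⊂q = ⊥-elim (<⇒≱ (p⊂q⇒∣p∣<∣q∣ p⊂q) ∣q∣≤∣p∣)

∃-largest : ∀ {P : Subset m → Set} → Decidable P → P p →
            ∃ λ q → P q × (∀ r → P r → ∣ r ∣ ≤ ∣ q ∣)
∃-largest {m = m} {p = p} {P = P} P? Pp = go m p Pp (m≤m+n m ∣ p ∣)
  where
  -- the fuel k bounds how much larger a P-set can still get
  go : ∀ k q → P q → m ≤ k +ℕ ∣ q ∣ → ∃ λ q → P q × (∀ r → P r → ∣ r ∣ ≤ ∣ q ∣)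
  go zero q Pq m≤∣q∣ = q , Pq , λ r _ → ≤-trans (∣p∣≤n r) m≤∣q∣
  go (suc k) q Pq m≤ with anySubset? (λ r → P? r ×-dec (suc ∣ q ∣ ≤? ∣ r ∣))
  ... | yes (r , Pr , ∣q∣<∣r∣) =
    go k r Pr (≤-trans m≤ (≤-trans (≤-reflexive (≡.sym (+-suc k ∣ q ∣))) (+-monoʳ-≤ k ∣q∣<∣r∣)))
  ... | no ∄larger = q , Pq , λ r Pr → ≮⇒≥ (λ ∣q∣<∣r∣ → ∄larger (r , Pr , ∣q∣<∣r∣))

∉-insertAt-outside : ∀ (p : Subset m) i → i ∉ insertAt p i outside
∉-insertAt-outside p i i∈ with ≡.trans (≡.sym ([]=⇒lookup i∈)) (insertAt-lookup p i outside)
... | ()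

∈-insertAt-inside : ∀ (p : Subset m) i → i ∈ insertAt p i inside
∈-insertAt-inside p i = lookup⇒[]= i _ (insertAt-lookup p i inside)

insertAt-inside≡∪⁅⁆ : ∀ (p : Subset m) i → insertAt p i inside ≡ insertAt p i outside ∪ ⁅ i ⁆
insertAt-inside≡∪⁅⁆ p       zero    = cong (inside ∷_) (≡.sym (∪-identityʳ p))
insertAt-inside≡∪⁅⁆ (x ∷ p) (suc i) =
  cong₂ _∷_ (≡.sym (∨-identityʳ x)) (insertAt-inside≡∪⁅⁆ p i)

true-equivalent⇒≡ : ∀ {a b : Bool} → (a ≡ true → b ≡ true) → (b ≡ true → a ≡ true) → a ≡ b
true-equivalent⇒≡ {false} {false} _ _ = refl
true-equivalent⇒≡ {true}  {true}  _ _ = refl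
true-equivalent⇒≡ {true}  {false} a⇒b _ with a⇒b refl
... | ()
true-equivalent⇒≡ {false} {true}  _ b⇒a with b⇒a refl
... | ()

module SemimatroidProperties {n : ℕ} (M : Semimatroid n) where
  open Semimatroid M
  open IsSemimatroid isSemimatroid

  private
    variable
      A I K X Y : Subset n
      d e : Fin n

  Central : Subset n → Set
  Central = IsCentral pre

  Independent : Subset n → Set
  Independent = IsIndependent pre

  central-⊆ : X ⊆ Y → Central Y → Central X
  central-⊆ = downClosed _ _

  central? : Decidable Central
  central? X = central X ≟ᵇ true

  independent? : Decidable Independent
  independent? X = central? X ×-dec (rank X ≟ ∣ X ∣)

  ⊥-independent : Central X → Independent ⊥
  ⊥-independent cX = c⊥ , ≡.trans (n≤0⇒n≡0 (≤-trans (SR1 ⊥ c⊥) (≤-reflexive (∣⊥∣≡0 n)))) (≡.sym (∣⊥∣≡0 n))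
    where c⊥ = central-⊆ ⊥⊆ cX

  rank-∪⁅⁆-≤ : Central (X ∪ ⁅ d ⁆) → rank (X ∪ ⁅ d ⁆) ≤ rank X +ℕ rank ⁅ d ⁆
  rank-∪⁅⁆-≤ {X} {d} c = ≤-trans (m≤n+m _ _)
    (SR3 X ⁅ d ⁆ (central-⊆ (p⊆p∪q ⁅ d ⁆) c) (central-⊆ (q⊆p∪q X ⁅ d ⁆) c) c)

  rank-⁅⁆-≤1 : Central ⁅ d ⁆ → rank ⁅ d ⁆ ≤ 1
  rank-⁅⁆-≤1 {d} c = ≤-trans (SR1 ⁅ d ⁆ c) (≤-reflexive (∣⁅x⁆∣≡1 d))

  rank-∪⁅⁆-≤-suc : Central (X ∪ ⁅ d ⁆) → rank (X ∪ ⁅ d ⁆) ≤ suc (rank X)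
  rank-∪⁅⁆-≤-suc {X} {d} c = ≤-trans (rank-∪⁅⁆-≤ c)
    (≤-trans (+-monoʳ-≤ (rank X) (rank-⁅⁆-≤1 (central-⊆ (q⊆p∪q X ⁅ d ⁆) c)))
             (≤-reflexive (ℕ.+-comm (rank X) 1)))

  rank-⊆-≤ : ∀ k → X ⊆ Y → Central Y → ∣ Y ∣ ≡ k +ℕ ∣ X ∣ → rank Y ≤ k +ℕ rank X
  rank-⊆-≤ zero X⊆Y _ ∣Y∣≡∣X∣ = ≤-reflexive (cong rank (p⊆q∧∣q∣≤∣p∣⇒q≡p X⊆Y (≤-reflexive ∣Y∣≡∣X∣)))
  rank-⊆-≤ {X} {Y} (suc k) X⊆Y cY ∣Y∣≡ with p⊆q⇒q≡p⊎p⊂q X⊆Y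
  ... | inj₁ refl = ⊥-elim (<⇒≱ (≤-trans (s≤s (m≤n+m ∣ X ∣ k)) (≤-reflexive (≡.sym ∣Y∣≡))) ≤-refl)
  ... | inj₂ (_ , d , d∈Y , d∉X) =
    ≤-trans (rank-⊆-≤ k Xd⊆Y cY ∣Y∣≡k+∣Xd∣)
            (≤-trans (+-monoʳ-≤ k (rank-∪⁅⁆-≤-suc (central-⊆ Xd⊆Y cY))) (≤-reflexive (+-suc k (rank X))))
    where
    Xd⊆Y : X ∪ ⁅ d ⁆ ⊆ Y
    Xd⊆Y = ∪-least X⊆Y (x∈p⇒⁅x⁆⊆p d∈Y)
    ∣Y∣≡k+∣Xd∣ : ∣ Y ∣ ≡ k +ℕ ∣ X ∪ ⁅ d ⁆ ∣
    ∣Y∣≡k+∣Xd∣ = ≡.trans ∣Y∣≡ (≡.trans (≡.sym (+-suc k ∣ X ∣)) (cong (k +ℕ_) (≡.sym (∣p∪⁅x⁆∣≡1+∣p∣ X d d∉X))))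

  independent-⊆ : X ⊆ Y → Independent Y → Independent X
  independent-⊆ {X} {Y} X⊆Y (cY , rY≡∣Y∣) = cX , ≤-antisym (SR1 X cX) (+-cancelˡ-≤ k _ _ k+∣X∣≤k+rX)
    where
    cX = central-⊆ X⊆Y cY
    k = ∣ Y ∣ ∸ ∣ X ∣
    ∣Y∣≡k+∣X∣ : ∣ Y ∣ ≡ k +ℕ ∣ X ∣
    ∣Y∣≡k+∣X∣ = ≡.sym (m∸n+n≡m (p⊆q⇒∣p∣≤∣q∣ X⊆Y))
    k+∣X∣≤k+rX : k +ℕ ∣ X ∣ ≤ k +ℕ rank X
    k+∣X∣≤k+rX = ≤-trans (≤-reflexive (≡.trans (≡.sym ∣Y∣≡k+∣X∣) (≡.sym rY≡∣Y∣)))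
                         (rank-⊆-≤ k X⊆Y cY ∣Y∣≡k+∣X∣)

  independent-augment : I ⊆ K → Independent I → Central K → rank K ≡ ∣ I ∣ → d ∉ K →
                        Central (K ∪ ⁅ d ⁆) → ∣ I ∣ < rank (K ∪ ⁅ d ⁆) → Independent (I ∪ ⁅ d ⁆)
  independent-augment {I} {K} {d} I⊆K (cI , rI) cK rK d∉K cKd ∣I∣<rKd =
    cId , ≤-antisym (SR1 _ cId) (≤-trans (≤-reflexive (∣p∪⁅x⁆∣≡1+∣p∣ I d (λ d∈I → d∉K (I⊆K d∈I))))
                                         (≤-trans ∣I∣<rKd rKd≤rId))
    where
    open ≤-Reasoning
    Id⊆Kd : I ∪ ⁅ d ⁆ ⊆ K ∪ ⁅ d ⁆
    Id⊆Kd = ∪-least (⊆-trans I⊆K (p⊆p∪q ⁅ d ⁆)) (q⊆p∪q K ⁅ d ⁆)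
    cId = central-⊆ Id⊆Kd cKd
    cIdK : Central ((I ∪ ⁅ d ⁆) ∪ K)
    cIdK = central-⊆ (∪-least Id⊆Kd (p⊆p∪q ⁅ d ⁆)) cKd
    Kd⊆IdK : K ∪ ⁅ d ⁆ ⊆ (I ∪ ⁅ d ⁆) ∪ K
    Kd⊆IdK = ∪-least (q⊆p∪q _ K) (⊆-trans (q⊆p∪q I ⁅ d ⁆) (p⊆p∪q K))
    I⊆Id∩K : I ⊆ (I ∪ ⁅ d ⁆) ∩ K
    I⊆Id∩K x∈I = x∈p∩q⁺ (p⊆p∪q ⁅ d ⁆ x∈I , I⊆K x∈I)
    ∣I∣≤rId∩K : ∣ I ∣ ≤ rank ((I ∪ ⁅ d ⁆) ∩ K)
    ∣I∣≤rId∩K = ≤-trans (≤-reflexive (≡.sym rI)) (SR2 _ _ cI (central-⊆ (p∩q⊆q _ K) cK) I⊆Id∩K)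
    rKd≤rId : rank (K ∪ ⁅ d ⁆) ≤ rank (I ∪ ⁅ d ⁆)
    rKd≤rId = +-cancelˡ-≤ ∣ I ∣ _ _ (begin
      ∣ I ∣ +ℕ rank (K ∪ ⁅ d ⁆)
        ≤⟨ +-mono-≤ ∣I∣≤rId∩K (SR2 _ _ cKd cIdK Kd⊆IdK) ⟩
      rank ((I ∪ ⁅ d ⁆) ∩ K) +ℕ rank ((I ∪ ⁅ d ⁆) ∪ K)
        ≤⟨ SR3 _ K cId cK cIdK ⟩
      rank (I ∪ ⁅ d ⁆) +ℕ rank K
        ≡⟨ cong (rank (I ∪ ⁅ d ⁆) +ℕ_) rK ⟩
      rank (I ∪ ⁅ d ⁆) +ℕ ∣ I ∣
        ≡⟨ ℕ.+-comm _ ∣ I ∣ ⟩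
      ∣ I ∣ +ℕ rank (I ∪ ⁅ d ⁆) ∎)

  rank≡∣maximumIndependent∣ : Central A → I ⊆ A → Independent I →
                              (∀ J → J ⊆ A × Independent J → ∣ J ∣ ≤ ∣ I ∣) → rank A ≡ ∣ I ∣
  rank≡∣maximumIndependent∣ {A} {I} cA I⊆A (cI , rI) maximumI =
    ≤-antisym (≮⇒≥ ∣I∣≮rA) (≤-trans (≤-reflexive (≡.sym rI)) (SR2 I A cI cA I⊆A))
    where
    Between : Subset n → Set
    Between K = I ⊆ K × K ⊆ A × Central K × rank K ≡ ∣ I ∣
    between? : Decidable Between
    between? K = (I ⊆? K) ×-dec ((K ⊆? A) ×-dec (central? K ×-dec (rank K ≟ ∣ I ∣)))
    -- SR5 adds some d ∈ A to a largest K ∈ Between; K ∪ {d} cannot stay in Between,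
    -- so its rank rises and I ∪ {d} would be a larger independent subset of A.
    ∣I∣≮rA : ¬ (∣ I ∣ < rank A)
    ∣I∣≮rA ∣I∣<rA with ∃-largest between? (⊆-refl , I⊆A , cI , rI)
    ... | K , (I⊆K , K⊆A , cK , rK) , largestK with SR5 K A cK cA (≤-trans (s≤s (≤-reflexive rK)) ∣I∣<rA)
    ... | d , d∈A , d∉K , cKd with rank (K ∪ ⁅ d ⁆) ≟ ∣ I ∣
    ... | yes rKd = <⇒≱ (≤-reflexive (≡.sym (∣p∪⁅x⁆∣≡1+∣p∣ K d d∉K)))
          (largestK _ (⊆-trans I⊆K (p⊆p∪q _) , ∪-least K⊆A (x∈p⇒⁅x⁆⊆p d∈A) , cKd , rKd))
    ... | no rKd≢ = <⇒≱ (≤-reflexive (≡.sym (∣p∪⁅x⁆∣≡1+∣p∣ I d (λ d∈I → d∉K (I⊆K d∈I)))))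
          (maximumI _ (∪-least I⊆A (x∈p⇒⁅x⁆⊆p d∈A) ,
                       independent-augment I⊆K (cI , rI) cK rK d∉K cKd ∣I∣<rKd))
      where
      ∣I∣<rKd : ∣ I ∣ < rank (K ∪ ⁅ d ⁆)
      ∣I∣<rKd = ≤∧≢⇒< (≤-trans (≤-reflexive (≡.sym rK)) (SR2 K _ cK cKd (p⊆p∪q ⁅ d ⁆)))
                      (λ eq → rKd≢ (≡.sym eq))

  loop-∪⁅⁆ : IsLoop pre e → Central A → Central (A ∪ ⁅ e ⁆) × rank (A ∪ ⁅ e ⁆) ≡ rank A
  loop-∪⁅⁆ {e} {A} (ce , re≡0) cA = cAe , ≤-antisym
      (≤-trans (rank-∪⁅⁆-≤ cAe) (≤-reflexive (≡.trans (cong (rank A +ℕ_) re≡0) (ℕ.+-identityʳ _))))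
      (SR2 A _ cA cAe (p⊆p∪q ⁅ e ⁆))
    where
    re≡re∩A : rank ⁅ e ⁆ ≡ rank (⁅ e ⁆ ∩ A)
    re≡re∩A = ≡.trans re≡0 (≡.sym (n≤0⇒n≡0 (≤-trans
      (SR2 _ _ (central-⊆ (p∩q⊆p ⁅ e ⁆ A) ce) ce (p∩q⊆p ⁅ e ⁆ A)) (≤-reflexive re≡0))))
    cAe : Central (A ∪ ⁅ e ⁆)
    cAe = subst Central (∪-comm ⁅ e ⁆ A) (SR4 ⁅ e ⁆ A ce cA re≡re∩A)

  -- I is a maximum independent subset of A and B ⊇ I a basis; e ∈ B makes I ∪ {e}
  -- independent, and r(A) = |I| = r(A ∩ (I ∪ {e})) lets SR4 join A and I ∪ {e}.
  isthmus-∪⁅⁆ : IsIsthmus pre e → Central A → e ∉ A →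
                Central (A ∪ ⁅ e ⁆) × rank (A ∪ ⁅ e ⁆) ≡ suc (rank A)
  isthmus-∪⁅⁆ {e} {A} (_ , e∈bases) cA e∉A
    with ∃-largest (λ J → (J ⊆? A) ×-dec independent? J) (⊥⊆ , ⊥-independent cA)
  ... | I , (I⊆A , indI) , maximumI
    with ∃-largest (λ J → (I ⊆? J) ×-dec independent? J) (⊆-refl , indI)
  ... | B , (I⊆B , indB) , maximumB = cAe , ≤-antisym (rank-∪⁅⁆-≤-suc cAe) 1+rA≤rAe
    where
    rA≡∣I∣ : rank A ≡ ∣ I ∣
    rA≡∣I∣ = rank≡∣maximumIndependent∣ cA I⊆A indI maximumI
    basisB : IsBasis pre B
    basisB = indB , λ Y indY B⊆Y → p⊆q∧∣q∣≤∣p∣⇒q≡p B⊆Y (maximumB Y (⊆-trans I⊆B B⊆Y , indY))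
    Ie = I ∪ ⁅ e ⁆
    indIe : Independent Ie
    indIe = independent-⊆ (∪-least I⊆B (x∈p⇒⁅x⁆⊆p (e∈bases B basisB))) indB
    rIe≡1+rA : rank Ie ≡ suc (rank A)
    rIe≡1+rA = ≡.trans (proj₂ indIe)
      (≡.trans (∣p∪⁅x⁆∣≡1+∣p∣ I e (λ e∈I → e∉A (I⊆A e∈I))) (cong suc (≡.sym rA≡∣I∣)))
    cA∩Ie = central-⊆ (p∩q⊆p A Ie) cA
    rA≡rA∩Ie : rank A ≡ rank (A ∩ Ie)
    rA≡rA∩Ie = ≤-antisym
      (≤-trans (≤-reflexive (≡.trans rA≡∣I∣ (≡.sym (proj₂ indI))))
               (SR2 I _ (proj₁ indI) cA∩Ie (λ x∈I → x∈p∩q⁺ (I⊆A x∈I , p⊆p∪q ⁅ e ⁆ x∈I))))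
      (SR2 _ A cA∩Ie cA (p∩q⊆p A Ie))
    cAe : Central (A ∪ ⁅ e ⁆)
    cAe = central-⊆ (∪-least (p⊆p∪q Ie) (⊆-trans (q⊆p∪q I ⁅ e ⁆) (q⊆p∪q A Ie)))
                    (SR4 A Ie cA (proj₁ indIe) rA≡rA∩Ie)
    1+rA≤rAe : suc (rank A) ≤ rank (A ∪ ⁅ e ⁆)
    1+rA≤rAe = ≤-trans (≤-reflexive (≡.sym rIe≡1+rA))
      (SR2 Ie _ (proj₁ indIe) cAe (∪-least (⊆-trans I⊆A (p⊆p∪q ⁅ e ⁆)) (q⊆p∪q A ⁅ e ⁆)))

  rank-⁅⁆≡1 : Central ⁅ e ⁆ → ¬ IsLoop pre e → rank ⁅ e ⁆ ≡ 1
  rank-⁅⁆≡1 ce ¬loop = ≤-antisym (rank-⁅⁆-≤1 ce) (n≢0⇒n>0 (λ re≡0 → ¬loop (ce , re≡0)))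

  rank≡1+contractedRank : ¬ IsLoop pre e → Central A → e ∈ A → rank A ≡ 1 +ℕ (rank A ∸ rank ⁅ e ⁆)
  rank≡1+contractedRank {e} {A} ¬loop cA e∈A =
    ≡.trans (≡.sym (m+[n∸m]≡n (SR2 _ A ce cA ⁅e⁆⊆A))) (cong (_+ℕ (rank A ∸ rank ⁅ e ⁆)) (rank-⁅⁆≡1 ce ¬loop))
    where
    ⁅e⁆⊆A = x∈p⇒⁅x⁆⊆p e∈A
    ce = central-⊆ ⁅e⁆⊆A cA

module SubsetSums {c ℓ : Level} (R : CommutativeRing c ℓ) where
  open CommutativeRing R renaming (refl to ≈-refl; sym to ≈-sym; trans to ≈-trans) hiding (zero)
  open Poly R
  open import Relation.Binary.Reasoning.Setoid setoid
  open CommutativeSemigroupProperties +-commutativeSemigroup using (interchange)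

  sumSubsets : ∀ n → (Subset n → Carrier) → Carrier
  sumSubsets n f = sumList (map f (allSubsets n))

  sumList-++ : ∀ xs ys → sumList (xs ++ ys) ≈ sumList xs + sumList ys
  sumList-++ []       ys = ≈-sym (+-identityˡ _)
  sumList-++ (x ∷ xs) ys = ≈-trans (+-congˡ (sumList-++ xs ys)) (≈-sym (+-assoc _ _ _))

  module _ {A : Set} where

    sumList-map-cong : ∀ (xs : List A) {f g : A → Carrier} →
                       (∀ a → f a ≈ g a) → sumList (map f xs) ≈ sumList (map g xs)
    sumList-map-cong []       _   = ≈-refl
    sumList-map-cong (a ∷ xs) f≈g = +-cong (f≈g a) (sumList-map-cong xs f≈g)

    sumList-map-0# : ∀ (xs : List A) → sumList (map (λ _ → 0#) xs) ≈ 0#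
    sumList-map-0# []       = ≈-refl
    sumList-map-0# (a ∷ xs) = ≈-trans (+-identityˡ _) (sumList-map-0# xs)

    sumList-map-*ˡ : ∀ (xs : List A) k (f : A → Carrier) →
                     sumList (map (λ a → k * f a) xs) ≈ k * sumList (map f xs)
    sumList-map-*ˡ []       k f = ≈-sym (zeroʳ k)
    sumList-map-*ˡ (a ∷ xs) k f = ≈-trans (+-congˡ (sumList-map-*ˡ xs k f)) (≈-sym (distribˡ k _ _))

  sumSubsets-cong : ∀ {n} {f g : Subset n → Carrier} → (∀ Y → f Y ≈ g Y) → sumSubsets n f ≈ sumSubsets n g
  sumSubsets-cong {n} = sumList-map-cong (allSubsets n)

  sumSubsets-0# : ∀ n → sumSubsets n (λ _ → 0#) ≈ 0#
  sumSubsets-0# n = sumList-map-0# (allSubsets n)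

  sumSubsets-*ˡ : ∀ {n} k (f : Subset n → Carrier) → sumSubsets n (λ Y → k * f Y) ≈ k * sumSubsets n f
  sumSubsets-*ˡ {n} = sumList-map-*ˡ (allSubsets n)

  sumSubsets-suc : ∀ {n} (f : Subset (suc n) → Carrier) →
                   sumSubsets (suc n) f ≈ sumSubsets n (λ Y → f (outside ∷ Y)) + sumSubsets n (λ Y → f (inside ∷ Y))
  sumSubsets-suc {n} f = begin
    sumList (map f (map (outside ∷_) L ++ map (inside ∷_) L))
      ≡⟨ cong sumList (map-++ f (map (outside ∷_) L) (map (inside ∷_) L)) ⟩
    sumList (map f (map (outside ∷_) L) ++ map f (map (inside ∷_) L))
      ≈⟨ sumList-++ (map f (map (outside ∷_) L)) (map f (map (inside ∷_) L)) ⟩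
    sumList (map f (map (outside ∷_) L)) + sumList (map f (map (inside ∷_) L))
      ≡⟨ cong₂ (λ u v → sumList u + sumList v) (≡.sym (map-∘ L)) (≡.sym (map-∘ L)) ⟩
    sumSubsets n (λ Y → f (outside ∷ Y)) + sumSubsets n (λ Y → f (inside ∷ Y)) ∎
    where L = allSubsets n

  sumSubsets-insertAt : ∀ {n} (f : Subset (suc n) → Carrier) i →
    sumSubsets (suc n) f ≈ sumSubsets n (λ Y → f (insertAt Y i outside)) + sumSubsets n (λ Y → f (insertAt Y i inside))
  sumSubsets-insertAt f zero = sumSubsets-suc f
  sumSubsets-insertAt {suc n} f (suc i) = begin
    sumSubsets (suc (suc n)) f
      ≈⟨ sumSubsets-suc f ⟩
    Σ (λ Y → f (outside ∷ Y)) + Σ (λ Y → f (inside ∷ Y))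
      ≈⟨ +-cong (sumSubsets-insertAt (λ Y → f (outside ∷ Y)) i) (sumSubsets-insertAt (λ Y → f (inside ∷ Y)) i) ⟩
    (Σ′ (λ Y → f (outside ∷ insertAt Y i outside)) + Σ′ (λ Y → f (outside ∷ insertAt Y i inside)))
      + (Σ′ (λ Y → f (inside ∷ insertAt Y i outside)) + Σ′ (λ Y → f (inside ∷ insertAt Y i inside)))
      ≈⟨ interchange _ _ _ _ ⟩
    (Σ′ (λ Y → f (outside ∷ insertAt Y i outside)) + Σ′ (λ Y → f (inside ∷ insertAt Y i outside)))
      + (Σ′ (λ Y → f (outside ∷ insertAt Y i inside)) + Σ′ (λ Y → f (inside ∷ insertAt Y i inside)))
      ≈⟨ ≈-sym (+-cong (sumSubsets-suc (λ Y → f (insertAt Y (suc i) outside)))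
                       (sumSubsets-suc (λ Y → f (insertAt Y (suc i) inside)))) ⟩
    Σ (λ Y → f (insertAt Y (suc i) outside)) + Σ (λ Y → f (insertAt Y (suc i) inside)) ∎
    where
    Σ = sumSubsets (suc n)
    Σ′ = sumSubsets n

module Terms {c ℓ : Level} (R : CommutativeRing c ℓ) where
  open CommutativeRing R renaming (refl to ≈-refl; sym to ≈-sym; trans to ≈-trans) hiding (zero)
  open Poly R
  open import Relation.Binary.Reasoning.Setoid setoid
  open CommutativeSemigroupProperties *-commutativeSemigroup using (interchange; x∙yz≈y∙xz)

  monomial-insertAt-outside : ∀ {n} (x : Fin (suc n) → Carrier) i Y →
                              monomial x (insertAt Y i outside) ≡ monomial (λ j → x (punchIn i j)) Y
  monomial-insertAt-outside x zero    Y           = refl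
  monomial-insertAt-outside x (suc i) (true ∷ Y)  = cong (x zero *_) (monomial-insertAt-outside (λ j → x (suc j)) i Y)
  monomial-insertAt-outside x (suc i) (false ∷ Y) = monomial-insertAt-outside (λ j → x (suc j)) i Y

  monomial-insertAt-inside : ∀ {n} (x : Fin (suc n) → Carrier) i Y →
                             monomial x (insertAt Y i inside) ≈ x i * monomial (λ j → x (punchIn i j)) Y
  monomial-insertAt-inside x zero    Y           = ≈-refl
  monomial-insertAt-inside x (suc i) (true ∷ Y)  =
    ≈-trans (*-congˡ (monomial-insertAt-inside (λ j → x (suc j)) i Y)) (x∙yz≈y∙xz _ _ _)
  monomial-insertAt-inside x (suc i) (false ∷ Y) = monomial-insertAt-inside (λ j → x (suc j)) i Y

  pow-+ : ∀ μ j k → pow μ (j +ℕ k) ≈ pow μ j * pow μ k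
  pow-+ μ zero    k = ≈-sym (*-identityˡ _)
  pow-+ μ (suc j) k = ≈-trans (*-congˡ (pow-+ μ j k)) (≈-sym (*-assoc _ _ _))

  -- `term` with its `with` on centrality made explicit, so that centrality and rank
  -- can be rewritten independently
  weight : Carrier → Bool → ℕ → Carrier → Carrier
  weight μ true  r a = pow μ r * a
  weight μ false r a = 0#

  term≡weight : ∀ {n} (C : PreSemimatroid n) μ x A →
                term C μ x A ≡ weight μ (PreSemimatroid.central C A) (PreSemimatroid.rank C A) (monomial x A)
  term≡weight C μ x A with PreSemimatroid.central C A
  ... | true  = refl
  ... | false = refl

  weight-congʳ : ∀ μ b r {a a′} → a ≈ a′ → weight μ b r a ≈ weight μ b r a′
  weight-congʳ μ true  r a≈a′ = *-congˡ a≈a′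
  weight-congʳ μ false r _    = ≈-refl

  weight-shift : ∀ μ b j r r′ k a → (b ≡ true → r′ ≡ j +ℕ r) →
                 weight μ b r′ (k * a) ≈ (k * pow μ j) * weight μ b r a
  weight-shift μ true j r r′ k a r′≡j+r rewrite r′≡j+r refl = begin
    pow μ (j +ℕ r) * (k * a)       ≈⟨ *-congʳ (pow-+ μ j r) ⟩
    (pow μ j * pow μ r) * (k * a)  ≈⟨ interchange _ _ _ _ ⟩
    (pow μ j * k) * (pow μ r * a)  ≈⟨ *-congʳ (*-comm _ _) ⟩
    (k * pow μ j) * (pow μ r * a)  ∎
  weight-shift μ false j r r′ k a _ = ≈-sym (zeroʳ _)

module DeletionContraction {c ℓ : Level} (R : CommutativeRing c ℓ) {n : ℕ}
         (M : Semimatroid (suc n)) (e : Fin (suc n))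
         (μ : CommutativeRing.Carrier R) (x : Fin (suc n) → CommutativeRing.Carrier R) where
  open CommutativeRing R renaming (refl to ≈-refl; sym to ≈-sym; trans to ≈-trans) hiding (zero)
  open Poly R
  open SubsetSums R
  open Terms R
  open SemimatroidProperties M
  open import Relation.Binary.Reasoning.Setoid setoid

  C : PreSemimatroid (suc n)
  C = Semimatroid.pre M
  open PreSemimatroid C using (central; rank)

  x₋ₑ : Fin n → Carrier
  x₋ₑ i = x (punchIn e i)

  Zd : Carrier
  Zd = Z (deletion C e) μ x₋ₑ

  Out In : Subset n → Subset (suc n)
  Out Y = insertAt Y e outside
  In  Y = insertAt Y e inside

  Z-split : Z C μ x ≈ Zd + sumSubsets n (λ Y → term C μ x (In Y))
  Z-split = ≈-trans (sumSubsets-insertAt (term C μ x) e) (+-congʳ (sumSubsets-cong term-Out))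
    where
    term-Out : ∀ Y → term C μ x (Out Y) ≈ term (deletion C e) μ x₋ₑ Y
    term-Out Y = reflexive (≡.trans (term≡weight C μ x (Out Y))
      (≡.trans (cong (weight μ (central (Out Y)) (rank (Out Y))) (monomial-insertAt-outside x e Y))
               (≡.sym (term≡weight (deletion C e) μ x₋ₑ Y))))

  term-In : ∀ Y → term C μ x (In Y) ≈ weight μ (central (In Y)) (rank (In Y)) (x e * monomial x₋ₑ Y)
  term-In Y = ≈-trans (reflexive (term≡weight C μ x (In Y)))
                      (weight-congʳ μ (central (In Y)) (rank (In Y)) (monomial-insertAt-inside x e Y))

  Z-scaledInner : ∀ k → (∀ Y → term C μ x (In Y) ≈ k * term (deletion C e) μ x₋ₑ Y) → Z C μ x ≈ (k + 1#) * Zd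
  Z-scaledInner k inner≈ = begin
    Z C μ x                                      ≈⟨ Z-split ⟩
    Zd + sumSubsets n (λ Y → term C μ x (In Y))  ≈⟨ +-congˡ (sumSubsets-cong inner≈) ⟩
    Zd + sumSubsets n (λ Y → k * term (deletion C e) μ x₋ₑ Y)  ≈⟨ +-congˡ (sumSubsets-*ˡ {n} k _) ⟩
    Zd + k * Zd                                  ≈⟨ +-comm _ _ ⟩
    k * Zd + Zd                                  ≈⟨ +-congˡ (≈-sym (*-identityˡ Zd)) ⟩
    k * Zd + 1# * Zd                             ≈⟨ ≈-sym (distribʳ Zd k 1#) ⟩
    (k + 1#) * Zd                                ∎

  inner-shift : ∀ j → (∀ {Y} → Central (Out Y) → Central (In Y) × rank (In Y) ≡ j +ℕ rank (Out Y)) →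
                ∀ Y → term C μ x (In Y) ≈ (x e * pow μ j) * term (deletion C e) μ x₋ₑ Y
  inner-shift j grow Y = begin
    term C μ x (In Y)
      ≈⟨ term-In Y ⟩
    weight μ (central (In Y)) (rank (In Y)) (x e * monomial x₋ₑ Y)
      ≡⟨ cong (λ b → weight μ b (rank (In Y)) (x e * monomial x₋ₑ Y)) central-In≡Out ⟩
    weight μ (central (Out Y)) (rank (In Y)) (x e * monomial x₋ₑ Y)
      ≈⟨ weight-shift μ (central (Out Y)) j _ _ (x e) _ (λ c → proj₂ (grow c)) ⟩
    (x e * pow μ j) * weight μ (central (Out Y)) (rank (Out Y)) (monomial x₋ₑ Y)
      ≡⟨ cong ((x e * pow μ j) *_) (≡.sym (term≡weight (deletion C e) μ x₋ₑ Y)) ⟩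
    (x e * pow μ j) * term (deletion C e) μ x₋ₑ Y ∎
    where
    Out⊆In : Out Y ⊆ In Y
    Out⊆In = subst (Out Y ⊆_) (≡.sym (insertAt-inside≡∪⁅⁆ Y e)) (p⊆p∪q ⁅ e ⁆)
    central-In≡Out : central (In Y) ≡ central (Out Y)
    central-In≡Out = true-equivalent⇒≡ (central-⊆ Out⊆In) (λ c → proj₁ (grow c))

  Z-loop : IsLoop C e → Z C μ x ≈ (x e + 1#) * Zd
  Z-loop loop = ≈-trans (Z-scaledInner _ (inner-shift 0 grow)) (*-congʳ (+-congʳ (*-identityʳ (x e))))
    where
    grow : ∀ {Y} → Central (Out Y) → Central (In Y) × rank (In Y) ≡ rank (Out Y)
    grow {Y} c = subst (λ A → Central A × rank A ≡ rank (Out Y)) (≡.sym (insertAt-inside≡∪⁅⁆ Y e)) (loop-∪⁅⁆ loop c)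

  Z-isthmus : IsIsthmus C e → Z C μ x ≈ (x e * μ + 1#) * Zd
  Z-isthmus isthmus =
    ≈-trans (Z-scaledInner _ (inner-shift 1 grow)) (*-congʳ (+-congʳ (*-congˡ (*-identityʳ μ))))
    where
    grow : ∀ {Y} → Central (Out Y) → Central (In Y) × rank (In Y) ≡ suc (rank (Out Y))
    grow {Y} c = subst (λ A → Central A × rank A ≡ suc (rank (Out Y))) (≡.sym (insertAt-inside≡∪⁅⁆ Y e))
                       (isthmus-∪⁅⁆ isthmus c (∉-insertAt-outside Y e))

  Z-contract : ¬ IsLoop C e → Z C μ x ≈ Zd + (x e * μ) * Z (contraction C e) μ x₋ₑ
  Z-contract ¬loop = begin
    Z C μ x
      ≈⟨ Z-split ⟩
    Zd + sumSubsets n (λ Y → term C μ x (In Y))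
      ≈⟨ +-congˡ (sumSubsets-cong inner≈) ⟩
    Zd + sumSubsets n (λ Y → (x e * pow μ 1) * term (contraction C e) μ x₋ₑ Y)
      ≈⟨ +-congˡ (sumSubsets-*ˡ {n} _ _) ⟩
    Zd + (x e * pow μ 1) * Z (contraction C e) μ x₋ₑ
      ≈⟨ +-congˡ (*-congʳ (*-congˡ (*-identityʳ μ))) ⟩
    Zd + (x e * μ) * Z (contraction C e) μ x₋ₑ ∎
    where
    inner≈ : ∀ Y → term C μ x (In Y) ≈ (x e * pow μ 1) * term (contraction C e) μ x₋ₑ Y
    inner≈ Y = ≈-trans (term-In Y) (≈-trans
      (weight-shift μ (central (In Y)) 1 _ _ (x e) _ (λ c → rank≡1+contractedRank ¬loop c (∈-insertAt-inside Y e)))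
      (reflexive (cong ((x e * pow μ 1) *_) (≡.sym (term≡weight (contraction C e) μ x₋ₑ Y)))))

  Z-noncentral : ¬ Central ⁅ e ⁆ → Z C μ x ≈ Zd
  Z-noncentral ¬ce = begin
    Z C μ x                                      ≈⟨ Z-split ⟩
    Zd + sumSubsets n (λ Y → term C μ x (In Y))  ≈⟨ +-congˡ (sumSubsets-cong inner≈0) ⟩
    Zd + sumSubsets n (λ _ → 0#)                 ≈⟨ +-congˡ (sumSubsets-0# n) ⟩
    Zd + 0#                                      ≈⟨ +-identityʳ Zd ⟩
    Zd                                           ∎
    where
    inner≈0 : ∀ Y → term C μ x (In Y) ≈ 0#
    inner≈0 Y = reflexive (≡.trans (term≡weight C μ x (In Y))
      (cong (λ b → weight μ b (rank (In Y)) (monomial x (In Y)))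
            (¬-not (λ c → ¬ce (central-⊆ (x∈p⇒⁅x⁆⊆p (∈-insertAt-inside Y e)) c)))))

theorem2p1 : ∀ {c ℓ : Level} (R : CommutativeRing c ℓ) {n : ℕ}
    (M : Semimatroid (suc n)) (e : Fin (suc n))
    (lam mu : CommutativeRing.Carrier R) →
    CommutativeRing._≈_ R (CommutativeRing._*_ R lam mu) (CommutativeRing.1# R) →
    (x : Fin (suc n) → CommutativeRing.Carrier R) →
    let open CommutativeRing R
        open Poly R
        C = Semimatroid.pre M
        x₋ₑ = λ i → x (punchIn e i)
    in (IsLoop C e → Z C mu x ≈ (x e + 1#) * Z (deletion C e) mu x₋ₑ)
     × (IsIsthmus C e → Z C mu x ≈ (x e * mu + 1#) * Z (deletion C e) mu x₋ₑ)
     × (IsCentral C ⁅ e ⁆ → ¬ IsLoop C e → ¬ IsIsthmus C e →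
          Z C mu x ≈ Z (deletion C e) mu x₋ₑ + (x e * mu) * Z (contraction C e) mu x₋ₑ)
     × (¬ IsCentral C ⁅ e ⁆ → Z C mu x ≈ Z (deletion C e) mu x₋ₑ)
-- Z takes μ = λ⁻¹ as its argument.
theorem2p1 R M e _ mu _ x = Z-loop , Z-isthmus , (λ _ ¬loop _ → Z-contract ¬loop) , Z-noncentral
  where open DeletionContraction R M e mu x
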